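{- There is no flag ordering $O$ of $B(\mathrm{Cyc}_5)$ such that $\Gamma(O)$ is isomorphic (as a simplicial complex) to $\Gamma(P_5)$.
   Context: $B(\mathrm{Cyc}_5)$ is the building set on $[5]$ consisting of all sets $\{i,i+1,\dots,i+s\}$ with $i\in[5]$, $0\le s\le 4$, entries taken mod $5$ (the cyclic intervals). A building set $B$ on a finite set $S$ is a collection of nonempty subsets of $S$ closed under unions of intersecting pairs and containing all singletons; it is connected if $S\in B$. For $B$ on $[n]$ the nestohedron is $P_B=\sum_{I\in B}\Delta_I$ with $\Delta_I$ the convex hull of $\{e_i:i\in I\}$; $B$ is flag if $P_B$ is flag (every family of pairwise intersecting facets has nonempty intersection). A decomposition of $[n]$ in $B$ is a subset of $B$ forming a minimal flag building set on $[n]$, i.e. the collection of leaf-descendant sets of the vertices of a rooted binary tree with leaf set $[n]$. A flag ordering $O=(D,b_1,\dots,b_k)$ of a connected flag building set $B$ on $[n]$ is a decomposition $D$ of $[n]$ in $B$ together with an enumeration $b_1,\dots,b_k$ of $B\setminus D$ such that $B_j:=D\cup\{b_1,\dots,b_j\}$ is a flag building set for all $0\le j\le k$. For $j\in[k]$: $U_j=\{i<j: b_i\not\subseteq b_j$ and there is no $b\in B_{i-1}$ with $b\setminus b_j=b_i\setminus b_j\}$; $V_j=\{i<j: b_i\subseteq b_j$ and there is $b\in B_{i-1}$ with $b_i\subsetneq b\subsetneq b_j\}$. $\Gamma(O)$ is the clique complex of the graph on vertices $v(b_1),\dots,v(b_k)$ in which, for $i<j$, $v(b_i)\sim v(b_j)$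 iff $i\in U_j\cup V_j$. $\Gamma(P_5)$ (Nevo–Petersen) is the clique complex of the graph on vertex set $\{(l,r)\in[4]\times[4]: l\neq r\}$ in which $(l_1,r_1)$ and $(l_2,r_2)$ are adjacent iff $l_1,l_2,r_1,r_2$ are pairwise distinct and either ($l_1<l_2$ and $r_1<r_2$) or ($l_2<l_1$ and $r_2<r_1$). -}

module Defs where

open import Data.Nat using (ℕ; _≤_; _<_; _%_; _+_; _∸_; _≤ᵇ_)
open import Data.Fin using (Fin; toℕ)
open import Data.Fin.Subset as S using (Subset; ⁅_⁆; _∩_; _∪_; _─_; _⊆_; _⊂_; ⋃; Nonempty; Empty)
  renaming (⊤ to Full)
open import Data.Vec using (tabulate; lookup)
open import Data.Unit using () renaming (⊤ to Unit)
open import Data.List using (List; []; _∷_; _++_; length; take; map)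
open import Data.List.Membership.Propositional using (_∈_)
open import Data.List.Relation.Unary.All using (All)
open import Data.List.Relation.Unary.AllPairs using (AllPairs)
open import Data.List.Relation.Unary.Unique.Propositional using (Unique)
open import Data.Product using (Σ; ∃; _×_; _,_)
open import Data.Sum using (_⊎_)
open import Relation.Nullary using (¬_)
open import Relation.Binary.PropositionalEquality using (_≡_; _≢_)
open import Function.Bundles using (_⤖_; _⇔_; Bijection)
open import Data.Bool using (if_then_else_)
open import Data.Fin.Subset using (inside; outside)

-- Ground set [5] = {1,..,5} is modelled as Fin 5 = {0,..,4} (i ↦ i-1).
-- Subsets of [5] are Data.Fin.Subset 5.

Family : Set₁
Family = Subset 5 → Set

Disjoint : Subset 5 → Subset 5 → Set
Disjoint I J = Empty (I ∩ J)

-- The building set B(Cyc_5): cyclic intervals {i, i+1, ..., i+s} (mod 5)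

cycInterval : Fin 5 → Fin 5 → Subset 5
cycInterval i s = tabulate (λ x → if ((toℕ x + 5 ∸ toℕ i) % 5) ≤ᵇ toℕ s then inside else outside)

BCyc5 : Family
BCyc5 I = Σ (Fin 5) λ i → Σ (Fin 5) λ s → I ≡ cycInterval i s

IsBuildingSet : Family → Set
IsBuildingSet B =
  (∀ I → B I → Nonempty I)
  × (∀ (x : Fin 5) → B ⁅ x ⁆)
  × (∀ I J → B I → B J → Nonempty (I ∩ J) → B (I ∪ J))

-- Flagness of the nestohedron P_B, for a connected building set B on [5],
-- expressed through its face structure (Postnikov / Feichtner–Sturmfels):
-- the facets of P_B are F_I, I ∈ B ∖ {[5]}, and a set of facets
-- {F_I : I ∈ N} has nonempty intersection iff N is a nested set:
--   (N1) any two members are comparable or disjoint,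
--   (N2) the union of ≥ 2 pairwise disjoint members is not in B.

PairNested : Family → Subset 5 → Subset 5 → Set
PairNested B I J = (I ⊆ J ⊎ J ⊆ I) ⊎ (Disjoint I J × ¬ B (I ∪ J))

IsNested : Family → List (Subset 5) → Set
IsNested B N =
  All (λ I → B I × I ≢ Full) N
  × (∀ I J → I ∈ N → J ∈ N → (I ⊆ J ⊎ J ⊆ I) ⊎ Disjoint I J)
  × (∀ (M : List (Subset 5)) → All (_∈ N) M → AllPairs Disjoint M → 2 ≤ length M
       → ¬ B (⋃ M))

-- P_B is flag: every family of pairwise intersecting facets has nonempty intersection
IsFlag : Family → Set
IsFlag B = ∀ (N : List (Subset 5))
  → All (λ I → B I × I ≢ Full) N
  → (∀ I J → I ∈ N → J ∈ N → PairNested B I J)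
  → IsNested B N

-- Decompositions: leaf-descendant sets of a rooted binary tree with leaf set [5]

data Tree : Set where
  leaf : Fin 5 → Tree
  node : Tree → Tree → Tree

leafSet : Tree → Subset 5
leafSet (leaf x)   = ⁅ x ⁆
leafSet (node l r) = leafSet l ∪ leafSet r

WellLabelled : Tree → Set
WellLabelled (leaf x)   = Unit
WellLabelled (node l r) = Disjoint (leafSet l) (leafSet r) × WellLabelled l × WellLabelled r

IsTreeOn5 : Tree → Set
IsTreeOn5 t = WellLabelled t × leafSet t ≡ Full

descSets : Tree → List (Subset 5)
descSets (leaf x)   = ⁅ x ⁆ ∷ []
descSets (node l r) = leafSet (node l r) ∷ (descSets l ++ descSets r)

record FlagOrdering : Set where
  field
    tree      : Tree
    treeOK    : IsTreeOn5 tree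
    DinB      : All BCyc5 (descSets tree)
    -- the enumeration b_1, ..., b_k of B ∖ D (b_{i+1} = lookup bs i)
    bs        : List (Subset 5)
    bsUnique  : Unique bs
    bsEnum    : ∀ I → (I ∈ bs) ⇔ (BCyc5 I × ¬ (I ∈ descSets tree))
    flagSteps : ∀ j → j ≤ length bs →
                  IsBuildingSet (λ I → I ∈ descSets tree ⊎ I ∈ take j bs)
                  × IsFlag (λ I → I ∈ descSets tree ⊎ I ∈ take j bs)

module _ (O : FlagOrdering) where
  open FlagOrdering O

  k : ℕ
  k = length bs

  b : Fin k → Subset 5
  b = Data.List.lookup bs

  Bpre : ℕ → Family
  Bpre j I = I ∈ descSets tree ⊎ I ∈ take j bs

  -- With 0-based indices i, j : Fin k (paper index = index + 1),
  -- B_{i-1} (paper) = Bpre (toℕ i).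
  -- i ∈ U_j  (for i < j)
  InU : Fin k → Fin k → Set
  InU i j = ¬ (b i ⊆ b j)
            × ¬ (Σ (Subset 5) λ c → Bpre (toℕ i) c × (c ─ b j ≡ b i ─ b j))

  InV : Fin k → Fin k → Set
  InV i j = b i ⊆ b j
            × (Σ (Subset 5) λ c → Bpre (toℕ i) c × b i ⊂ c × c ⊂ b j)

  -- edge relation of the graph underlying Γ(O), on vertices v(b_i) ≅ Fin k
  ΓOAdj : Fin k → Fin k → Set
  ΓOAdj i j = (toℕ i < toℕ j × (InU i j ⊎ InV i j))
            ⊎ (toℕ j < toℕ i × (InU j i ⊎ InV j i))

-- Γ(P_5) (Nevo–Petersen); [4] modelled as Fin 4

record P5Vertex : Set where
  constructor ⟨_,_,_⟩
  field
    l   : Fin 4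
    r   : Fin 4
    l≢r : l ≢ r

P5Adj : P5Vertex → P5Vertex → Set
P5Adj ⟨ l₁ , r₁ , _ ⟩ ⟨ l₂ , r₂ , _ ⟩ =
  (l₁ ≢ l₂ × l₁ ≢ r₂ × r₁ ≢ l₂ × r₁ ≢ r₂)   -- (l₁ ≢ r₁, l₂ ≢ r₂ hold by definition)
  × ((toℕ l₁ < toℕ l₂ × toℕ r₁ < toℕ r₂) ⊎ (toℕ l₂ < toℕ l₁ × toℕ r₂ < toℕ r₁))

IsClique : {V : Set} → (V → V → Set) → List V → Set
IsClique G σ = ∀ x y → x ∈ σ → y ∈ σ → x ≢ y → G x y

CliqueComplexIso : {V W : Set} → (V → V → Set) → (W → W → Set) → Set
CliqueComplexIso {V} {W} G H =
  Σ (V ⤖ W) λ f → ∀ (σ : List V) → IsClique G σ ⇔ IsClique H (map (Bijection.to f) σ)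

-- Both complexes are clique complexes, so an isomorphism between them is an isomorphism
-- of their graphs. The graph of Γ(P₅) contains the 4-cycle (1,2) – (3,4) – (2,1) – (4,3),
-- whereas the graph of Γ(O) contains no 4-cycle, whatever the flag ordering O.
--
-- For the latter, every b_i is a cyclic interval of size 2, 3 or 4, and whether
-- v(b_i) ∼ v(b_j) is bounded above by a relation on these fifteen intervals that ignores
-- the ordering. A finite search shows that every 4-cycle of that relation has a vertex W whose
-- two neighbours form a frame around W: either two overlapping 2-intervals inside the
-- 4-interval W, one of them containing an end of W, or the two 2-intervals sticking out of
-- the 3-interval W on either side. Flagness of the building sets B_j says that a set none of
-- whose 2-element subintervals lies in B_j is not in B_j either, and playing this against
-- the definitions of U_j and V_j shows that W is never adjacent to both legs of a frame.
module Submission where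

open import Defs
open import Relation.Nullary using (¬_)

open import Data.Bool using () renaming (_≟_ to _≟ᵇ_)
open import Data.Empty using (⊥; ⊥-elim)
open import Data.Fin using (Fin; zero; suc; #_; toℕ) renaming (_≟_ to _≟ᶠ_)
open import Data.Fin.Properties using (toℕ<n)
open import Data.Fin.Subset using (Subset; ⁅_⁆; _∩_; _∪_; _─_; _⊆_; _⊂_; ⋃; Nonempty)
  renaming (⊤ to Full; _∈_ to _∈ˢ_)
open import Data.Fin.Subset.Properties using (_⊆?_; _⊂?_; nonempty?; x∈⁅y⁆⇒x≡y; x∈p∩q⁻; x∈p∪q⁻; ∈⊤; ⊆-⊂-trans; ⊂-irref)
open import Data.List using (List; []; _∷_; map; cartesianProduct; allFin; take; length; lookup; _++_)
open import Data.List.Properties using (length-map; take-suc)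
open import Data.List.Membership.Propositional using (_∈_; _∉_; find; lose)
open import Data.List.Membership.Propositional.Properties using (∈-map⁺; ∈-map⁻; ∈-cartesianProduct⁺; ∈-allFin; ∈-++⁺ˡ; ∈-++⁺ʳ; ∈-++⁻; ∈-lookup)
open import Data.List.Membership.DecPropositional using () renaming (_∈?_ to ∈-dec)
open import Data.List.Relation.Unary.All as All using (All; all?; []; _∷_)
open import Data.List.Relation.Unary.Any using (Any; any?; here; there)
open import Data.List.Relation.Unary.AllPairs as AllPairs using (AllPairs; allPairs?; []; _∷_)
import Data.List.Relation.Unary.AllPairs.Properties as AllPairsₚ
open import Data.List.Relation.Unary.Unique.Propositional using (Unique)
open import Data.Nat using (ℕ; zero; suc; _≤_; _<_; s≤s; z<s; s<s)
open import Data.Nat.Properties using (≤-refl; <-irrefl; <-trans; <⇒≤; ≤-trans; <-≤-trans; n<1+n; _≤?_; ≰⇒>)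
open import Data.Product using (Σ; ∃; _×_; _,_; proj₁; proj₂; uncurry)
open import Data.Product.Properties using (≡-dec)
open import Data.Sum using (_⊎_; inj₁; inj₂; swap; map₁; [_,_])
open import Data.Vec.Properties using () renaming (≡-dec to ≡-decᵛ)
open import Function using (_∘_; id)
open import Function.Bundles using (Bijection; Equivalence)
open import Relation.Binary.Definitions using (DecidableEquality)
open import Relation.Binary.PropositionalEquality using (_≡_; _≢_; refl; sym; trans; cong; subst; subst₂)
open import Relation.Nullary using (Dec; yes; no; ¬?)
open import Relation.Nullary.Decidable using (_×-dec_; _⊎-dec_; _→-dec_; toWitness)

module _ {A : Set} where

  ∈-take⁻ : ∀ {x : A} n xs → x ∈ take n xs → x ∈ xs
  ∈-take⁻ (suc n) (y ∷ xs) (here x≡y)  = here x≡y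
  ∈-take⁻ (suc n) (y ∷ xs) (there x∈) = there (∈-take⁻ n xs x∈)

  ∈-take-mono : ∀ {x : A} {m n} xs → m ≤ n → x ∈ take m xs → x ∈ take n xs
  ∈-take-mono {m = suc m} {suc n} (y ∷ xs) (s≤s m≤n) (here x≡y)  = here x≡y
  ∈-take-mono {m = suc m} {suc n} (y ∷ xs) (s≤s m≤n) (there x∈) = there (∈-take-mono xs m≤n x∈)

  ∈-take-suc⁻ : ∀ {y : A} xs (i : Fin (length xs)) →
                y ∈ take (suc (toℕ i)) xs → y ∈ take (toℕ i) xs ⊎ y ≡ lookup xs i
  ∈-take-suc⁻ xs i y∈ with ∈-++⁻ (take (toℕ i) xs) (subst (_ ∈_) (take-suc xs i) y∈)
  ... | inj₁ y∈take   = inj₁ y∈take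
  ... | inj₂ (here y≡) = inj₂ y≡

  lookup∈take : ∀ (xs : List A) i {n} → toℕ i < n → lookup xs i ∈ take n xs
  lookup∈take (x ∷ xs) zero    {suc n} _         = here refl
  lookup∈take (x ∷ xs) (suc i) {suc n} (s<s i<n) = there (lookup∈take xs i i<n)

  lookup∈take⇒< : ∀ {xs : List A} → Unique xs → ∀ i {n} → lookup xs i ∈ take n xs → toℕ i < n
  lookup∈take⇒< {x ∷ xs} _            zero    {suc n} _            = z<s
  lookup∈take⇒< {x ∷ xs} (x∉xs ∷ _)   (suc i) {suc n} (here xᵢ≡x)  = ⊥-elim (All.lookup x∉xs (∈-lookup i) (sym xᵢ≡x))
  lookup∈take⇒< {x ∷ xs} (_ ∷ unique) (suc i) {suc n} (there xᵢ∈) = s<s (lookup∈take⇒< unique i xᵢ∈)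

  lookup-injective : ∀ {xs : List A} → Unique xs → ∀ i j → lookup xs i ≡ lookup xs j → i ≡ j
  lookup-injective {x ∷ xs} _            zero    zero    _    = refl
  lookup-injective {x ∷ xs} (x∉xs ∷ _)   zero    (suc j) x≡xⱼ = ⊥-elim (All.lookup x∉xs (∈-lookup j) x≡xⱼ)
  lookup-injective {x ∷ xs} (x∉xs ∷ _)   (suc i) zero    xᵢ≡x = ⊥-elim (All.lookup x∉xs (∈-lookup i) (sym xᵢ≡x))
  lookup-injective {x ∷ xs} (_ ∷ unique) (suc i) (suc j) xᵢ≡xⱼ = cong suc (lookup-injective unique i j xᵢ≡xⱼ)

leafSet∈descSets : ∀ t → leafSet t ∈ descSets t
leafSet∈descSets (leaf x)   = here refl
leafSet∈descSets (node l r) = here refl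

⁅⁆∈descSets : ∀ t {x} → x ∈ˢ leafSet t → ⁅ x ⁆ ∈ descSets t
⁅⁆∈descSets (leaf y)   x∈ rewrite x∈⁅y⁆⇒x≡y y x∈ = here refl
⁅⁆∈descSets (node l r) x∈ with x∈p∪q⁻ (leafSet l) (leafSet r) x∈
... | inj₁ x∈l = there (∈-++⁺ˡ (⁅⁆∈descSets l x∈l))
... | inj₂ x∈r = there (∈-++⁺ʳ (descSets l) (⁅⁆∈descSets r x∈r))

record FourCycle {V : Set} (G : V → V → Set) : Set where
  field
    v₀ v₁ v₂ v₃ : V
    e₀₁   : G v₀ v₁
    e₁₂   : G v₁ v₂
    e₂₃   : G v₂ v₃
    e₃₀   : G v₃ v₀
    v₀≢v₂ : v₀ ≢ v₂
    v₁≢v₃ : v₁ ≢ v₃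

module _ {V W : Set} {G : V → V → Set} {H : W → W → Set} (iso : CliqueComplexIso G H) where

  private
    to : V → W
    to = Bijection.to (proj₁ iso)

  edge-reflected : ∀ {x y} → x ≢ y → H (to x) (to y) → H (to y) (to x) → G x y
  edge-reflected {x} {y} x≢y Hxy Hyx =
    Equivalence.from (proj₂ iso (x ∷ y ∷ [])) image-clique x y (here refl) (there (here refl)) x≢y
    where
    image-clique : IsClique H (to x ∷ to y ∷ [])
    image-clique _ _ (here refl)         (here refl)         w≢w = ⊥-elim (w≢w refl)
    image-clique _ _ (here refl)         (there (here refl)) _   = Hxy
    image-clique _ _ (there (here refl)) (here refl)         _   = Hyx
    image-clique _ _ (there (here refl)) (there (here refl)) w≢w = ⊥-elim (w≢w refl)

  fourCycle-reflected : (∀ u v → H u v → H v u) → (∀ u → ¬ H u u) → FourCycle H → FourCycle G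
  fourCycle-reflected H-sym H-irrefl cycle = record
    { v₀ = pre v₀ ; v₁ = pre v₁ ; v₂ = pre v₂ ; v₃ = pre v₃
    ; e₀₁ = pulled e₀₁ ; e₁₂ = pulled e₁₂ ; e₂₃ = pulled e₂₃ ; e₃₀ = pulled e₃₀
    ; v₀≢v₂ = v₀≢v₂ ∘ pre-injective ; v₁≢v₃ = v₁≢v₃ ∘ pre-injective
    }
    where
    open FourCycle cycle
    pre : W → V
    pre w = proj₁ (Bijection.strictlySurjective (proj₁ iso) w)
    to-pre : ∀ w → to (pre w) ≡ w
    to-pre w = proj₂ (Bijection.strictlySurjective (proj₁ iso) w)
    pre-injective : ∀ {w w'} → pre w ≡ pre w' → w ≡ w'
    pre-injective {w} {w'} pre-w≡pre-w' = trans (sym (to-pre w)) (trans (cong to pre-w≡pre-w') (to-pre w'))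
    pulled : ∀ {w w'} → H w w' → G (pre w) (pre w')
    pulled {w} {w'} Hww' =
      edge-reflected (λ pre-w≡pre-w' → H-irrefl w' (subst (λ z → H z w') (pre-injective pre-w≡pre-w') Hww'))
                     (subst₂ H (sym (to-pre w)) (sym (to-pre w')) Hww')
                     (subst₂ H (sym (to-pre w')) (sym (to-pre w)) (H-sym w w' Hww'))

_≟ˢ_ : DecidableEquality (Subset 5)
_≟ˢ_ = ≡-decᵛ _≟ᵇ_

⟦_⟧ : List (Fin 5) → Subset 5
⟦ xs ⟧ = ⋃ (map ⁅_⁆ xs)

intervals : List (Subset 5)
intervals = map (uncurry cycInterval) (cartesianProduct (allFin 5) (allFin 5))

properIntervals : List (Subset 5)
properIntervals = map (uncurry cycInterval) (cartesianProduct (allFin 5) (# 1 ∷ # 2 ∷ # 3 ∷ []))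

BCyc5⇒∈intervals : ∀ {Z} → BCyc5 Z → Z ∈ intervals
BCyc5⇒∈intervals (x , s , refl) = ∈-map⁺ (uncurry cycInterval) (∈-cartesianProduct⁺ (∈-allFin x) (∈-allFin s))

cycInterval-0 : ∀ x → cycInterval x zero ≡ ⁅ x ⁆
cycInterval-0 zero                         = refl
cycInterval-0 (suc zero)                   = refl
cycInterval-0 (suc (suc zero))             = refl
cycInterval-0 (suc (suc (suc zero)))       = refl
cycInterval-0 (suc (suc (suc (suc zero)))) = refl

cycInterval-4 : ∀ x → cycInterval x (# 4) ≡ Full
cycInterval-4 zero                         = refl
cycInterval-4 (suc zero)                   = refl
cycInterval-4 (suc (suc zero))             = refl
cycInterval-4 (suc (suc (suc zero)))       = refl
cycInterval-4 (suc (suc (suc (suc zero)))) = refl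

cycInterval∈properIntervals : ∀ x {s} → s ∈ (# 1 ∷ # 2 ∷ # 3 ∷ []) → cycInterval x s ∈ properIntervals
cycInterval∈properIntervals x s∈ = ∈-map⁺ (uncurry cycInterval) (∈-cartesianProduct⁺ (∈-allFin x) s∈)

BCyc5-cases : ∀ {Z} → BCyc5 Z → (∃ λ x → Z ≡ ⁅ x ⁆) ⊎ Z ∈ properIntervals ⊎ Z ≡ Full
BCyc5-cases (x , zero , refl)                       = inj₁ (x , cycInterval-0 x)
BCyc5-cases (x , suc zero , refl)                   = inj₂ (inj₁ (cycInterval∈properIntervals x (here refl)))
BCyc5-cases (x , suc (suc zero) , refl)             = inj₂ (inj₁ (cycInterval∈properIntervals x (there (here refl))))
BCyc5-cases (x , suc (suc (suc zero)) , refl)       = inj₂ (inj₁ (cycInterval∈properIntervals x (there (there (here refl)))))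
BCyc5-cases (x , suc (suc (suc (suc zero))) , refl) = inj₂ (inj₂ (cycInterval-4 x))

⁅⁆-disjoint : ∀ {x y : Fin 5} → x ≢ y → Disjoint ⁅ x ⁆ ⁅ y ⁆
⁅⁆-disjoint {x} {y} x≢y (z , z∈) with x∈p∩q⁻ ⁅ x ⁆ ⁅ y ⁆ z∈
... | z∈⁅x⁆ , z∈⁅y⁆ = x≢y (trans (sym (x∈⁅y⁆⇒x≡y x z∈⁅x⁆)) (x∈⁅y⁆⇒x≡y y z∈⁅y⁆))

⁅⁆≢Full : ∀ (x : Fin 5) → ⁅ x ⁆ ≢ Full
⁅⁆≢Full zero                         ()
⁅⁆≢Full (suc zero)                   ()
⁅⁆≢Full (suc (suc zero))             ()
⁅⁆≢Full (suc (suc (suc zero)))       ()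
⁅⁆≢Full (suc (suc (suc (suc zero)))) ()

-- In a flag family the singletons of ⟦ xs ⟧ are pairwise nested as soon as no pair of
-- them has its union in B, hence nested, hence their union is not in B.
pairs-absent⇒absent : (B : Family) → IsFlag B → (∀ x → B ⁅ x ⁆) →
                      ∀ xs → AllPairs _≢_ xs → 2 ≤ length xs →
                      (∀ {x y} → x ∈ xs → y ∈ xs → x ≢ y → ¬ B (⁅ x ⁆ ∪ ⁅ y ⁆)) →
                      ¬ B ⟦ xs ⟧
pairs-absent⇒absent B flag B⁅⁆ xs distinct 2≤ pair-absent =
  proj₂ (proj₂ (flag points (facets xs) pairNested)) points (All.tabulate id) disjoint 2≤points
  where
  points : List (Subset 5)
  points = map ⁅_⁆ xs
  facets : ∀ ys → All (λ I → B I × I ≢ Full) (map ⁅_⁆ ys)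
  facets []       = []
  facets (y ∷ ys) = (B⁅⁆ y , ⁅⁆≢Full y) ∷ facets ys
  pairNested : ∀ I J → I ∈ points → J ∈ points → PairNested B I J
  pairNested I J I∈ J∈ with ∈-map⁻ ⁅_⁆ I∈ | ∈-map⁻ ⁅_⁆ J∈
  ... | x , x∈ , refl | y , y∈ , refl with x ≟ᶠ y
  ...   | yes refl = inj₁ (inj₁ id)
  ...   | no x≢y   = inj₂ (⁅⁆-disjoint x≢y , pair-absent x∈ y∈ x≢y)
  disjoint : AllPairs Disjoint points
  disjoint = AllPairsₚ.map⁺ (AllPairs.map ⁅⁆-disjoint distinct)
  2≤points : 2 ≤ length points
  2≤points = subst (2 ≤_) (sym (length-map ⁅_⁆ xs)) 2≤

PairIntervalsIn : List (Fin 5) → List (Subset 5) → Set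
PairIntervalsIn xs Ls =
  AllPairs _≢_ xs × 2 ≤ length xs
  × All (λ x → All (λ y → x ≡ y ⊎ (⁅ x ⁆ ∪ ⁅ y ⁆) ∈ Ls ⊎ (⁅ x ⁆ ∪ ⁅ y ⁆) ∉ intervals) xs) xs

pairIntervalsIn? : ∀ xs Ls → Dec (PairIntervalsIn xs Ls)
pairIntervalsIn? xs Ls =
  allPairs? (λ x y → ¬? (x ≟ᶠ y)) xs ×-dec 2 ≤? length xs
  ×-dec all? (λ x → all? (λ y → x ≟ᶠ y ⊎-dec ∈-dec _≟ˢ_ (⁅ x ⁆ ∪ ⁅ y ⁆) Ls
                                     ⊎-dec ¬? (∈-dec _≟ˢ_ (⁅ x ⁆ ∪ ⁅ y ⁆) intervals)) xs) xs

-- The conditions i ∈ U_j and i ∈ V_j with B_{i-1} replaced by the sets present in every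
-- B_j (singletons and [5]) and by the sets that may be present in some B_j (intervals).
alwaysPresent : List (Subset 5)
alwaysPresent = Full ∷ map ⁅_⁆ (allFin 5)

MayU MayV MayPrecede MayAdj : Subset 5 → Subset 5 → Set
MayU X Y = ¬ X ⊆ Y × ¬ Any (λ c → c ─ Y ≡ X ─ Y) alwaysPresent
MayV X Y = X ⊆ Y × Any (λ c → X ⊆ c × c ⊆ Y × c ≢ X × c ≢ Y) intervals
MayPrecede X Y = MayU X Y ⊎ MayV X Y
MayAdj X Y = MayPrecede X Y ⊎ MayPrecede Y X

mayU? : ∀ X Y → Dec (MayU X Y)
mayU? X Y = ¬? (X ⊆? Y) ×-dec ¬? (any? (λ c → (c ─ Y) ≟ˢ (X ─ Y)) alwaysPresent)

mayV? : ∀ X Y → Dec (MayV X Y)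
mayV? X Y = X ⊆? Y ×-dec any? (λ c → X ⊆? c ×-dec c ⊆? Y ×-dec ¬? (c ≟ˢ X) ×-dec ¬? (c ≟ˢ Y)) intervals

mayPrecede? : ∀ X Y → Dec (MayPrecede X Y)
mayPrecede? X Y = mayU? X Y ⊎-dec mayV? X Y

mayAdj? : ∀ X Y → Dec (MayAdj X Y)
mayAdj? X Y = mayPrecede? X Y ⊎-dec mayPrecede? Y X

OnlyU : Subset 5 → Subset 5 → Set
OnlyU X Y = ¬ MayU Y X × ¬ MayV X Y × ¬ MayV Y X

onlyU? : ∀ X Y → Dec (OnlyU X Y)
onlyU? X Y = ¬? (mayU? Y X) ×-dec ¬? (mayV? X Y) ×-dec ¬? (mayV? Y X)

module NestedFrame (x₁ x₂ x₃ x₄ : Fin 5) where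

  p12 p23 p34 p123 p234 p1234 : Subset 5
  p12   = ⟦ x₁ ∷ x₂ ∷ [] ⟧
  p23   = ⟦ x₂ ∷ x₃ ∷ [] ⟧
  p34   = ⟦ x₃ ∷ x₄ ∷ [] ⟧
  p123  = ⟦ x₁ ∷ x₂ ∷ x₃ ∷ [] ⟧
  p234  = ⟦ x₂ ∷ x₃ ∷ x₄ ∷ [] ⟧
  p1234 = ⟦ x₁ ∷ x₂ ∷ x₃ ∷ x₄ ∷ [] ⟧

  Facts : Set
  Facts =
    p12 ⊂ p1234 × p23 ⊂ p1234 × p34 ─ p12 ≡ p1234 ─ p12 × p234 ─ p12 ≡ p1234 ─ p12 × p34 ≢ p1234
    × All (λ Z → p12 ⊂ Z → Z ⊂ p1234 → Z ≡ p123) intervals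
    × All (λ Z → p23 ⊂ Z → Z ⊂ p1234 → Z ≡ p123 ⊎ Z ≡ p234) intervals
    × PairIntervalsIn (x₁ ∷ x₂ ∷ x₃ ∷ x₄ ∷ []) (p12 ∷ p23 ∷ p34 ∷ [])
    × PairIntervalsIn (x₁ ∷ x₂ ∷ x₃ ∷ []) (p12 ∷ p23 ∷ [])
    × PairIntervalsIn (x₂ ∷ x₃ ∷ x₄ ∷ []) (p23 ∷ p34 ∷ [])
    × Nonempty (p123 ∩ p34) × p123 ∪ p34 ≡ p1234

  facts? : Dec Facts
  facts? =
    p12 ⊂? p1234 ×-dec p23 ⊂? p1234 ×-dec (p34 ─ p12) ≟ˢ (p1234 ─ p12)
    ×-dec (p234 ─ p12) ≟ˢ (p1234 ─ p12) ×-dec ¬? (p34 ≟ˢ p1234)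
    ×-dec all? (λ Z → p12 ⊂? Z →-dec Z ⊂? p1234 →-dec Z ≟ˢ p123) intervals
    ×-dec all? (λ Z → p23 ⊂? Z →-dec Z ⊂? p1234 →-dec (Z ≟ˢ p123 ⊎-dec Z ≟ˢ p234)) intervals
    ×-dec pairIntervalsIn? (x₁ ∷ x₂ ∷ x₃ ∷ x₄ ∷ []) (p12 ∷ p23 ∷ p34 ∷ [])
    ×-dec pairIntervalsIn? (x₁ ∷ x₂ ∷ x₃ ∷ []) (p12 ∷ p23 ∷ [])
    ×-dec pairIntervalsIn? (x₂ ∷ x₃ ∷ x₄ ∷ []) (p23 ∷ p34 ∷ [])
    ×-dec nonempty? (p123 ∩ p34) ×-dec (p123 ∪ p34) ≟ˢ p1234

module OuterFrame (x₀ x₁ x₂ x₃ x₄ : Fin 5) where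

  p01 p12 p23 p34 p123 : Subset 5
  p01  = ⟦ x₀ ∷ x₁ ∷ [] ⟧
  p12  = ⟦ x₁ ∷ x₂ ∷ [] ⟧
  p23  = ⟦ x₂ ∷ x₃ ∷ [] ⟧
  p34  = ⟦ x₃ ∷ x₄ ∷ [] ⟧
  p123 = ⟦ x₁ ∷ x₂ ∷ x₃ ∷ [] ⟧

  Facts : Set
  Facts =
    OnlyU p123 p01 × p23 ─ p01 ≡ p123 ─ p01
    × OnlyU p123 p34 × p12 ─ p34 ≡ p123 ─ p34
    × PairIntervalsIn (x₁ ∷ x₂ ∷ x₃ ∷ []) (p12 ∷ p23 ∷ []) × p12 ≢ p123 × p23 ≢ p123

  facts? : Dec Facts
  facts? =
    onlyU? p123 p01 ×-dec (p23 ─ p01) ≟ˢ (p123 ─ p01)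
    ×-dec onlyU? p123 p34 ×-dec (p12 ─ p34) ≟ˢ (p123 ─ p34)
    ×-dec pairIntervalsIn? (x₁ ∷ x₂ ∷ x₃ ∷ []) (p12 ∷ p23 ∷ [])
    ×-dec ¬? (p12 ≟ˢ p123) ×-dec ¬? (p23 ≟ˢ p123)

next : Fin 5 → Fin 5
next zero                         = # 1
next (suc zero)                   = # 2
next (suc (suc zero))             = # 3
next (suc (suc (suc zero)))       = # 4
next (suc (suc (suc (suc zero)))) = # 0

Triple Quad Quint : Set
Triple = Subset 5 × Subset 5 × Subset 5
Quad   = Fin 5 × Fin 5 × Fin 5 × Fin 5
Quint  = Fin 5 × Fin 5 × Fin 5 × Fin 5 × Fin 5

_≟³_ : DecidableEquality Triple
_≟³_ = ≡-dec _≟ˢ_ (≡-dec _≟ˢ_ _≟ˢ_)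

nestedQuads : List Quad
nestedQuads = map ascending (allFin 5) ++ map descending (allFin 5)
  where
  ascending descending : Fin 5 → Quad
  ascending  x = x , next x , next (next x) , next (next (next x))
  descending x = next (next (next x)) , next (next x) , next x , x

outerQuints : List Quint
outerQuints = map (λ x → x , next x , next (next x) , next (next (next x)) , next (next (next (next x)))) (allFin 5)

nestedFrame : Quad → Triple
nestedFrame (x₁ , x₂ , x₃ , x₄) = p1234 , p12 , p23
  where open NestedFrame x₁ x₂ x₃ x₄

outerFrame : Quint → Triple
outerFrame (x₀ , x₁ , x₂ , x₃ , x₄) = p123 , p01 , p34
  where open OuterFrame x₀ x₁ x₂ x₃ x₄

NestedFacts : Quad → Set
NestedFacts (x₁ , x₂ , x₃ , x₄) = NestedFrame.Facts x₁ x₂ x₃ x₄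

nestedFacts? : ∀ q → Dec (NestedFacts q)
nestedFacts? (x₁ , x₂ , x₃ , x₄) = NestedFrame.facts? x₁ x₂ x₃ x₄

OuterFacts : Quint → Set
OuterFacts (x₀ , x₁ , x₂ , x₃ , x₄) = OuterFrame.Facts x₀ x₁ x₂ x₃ x₄

outerFacts? : ∀ q → Dec (OuterFacts q)
outerFacts? (x₀ , x₁ , x₂ , x₃ , x₄) = OuterFrame.facts? x₀ x₁ x₂ x₃ x₄

nestedFrameFacts : All NestedFacts nestedQuads
nestedFrameFacts = toWitness {a? = all? nestedFacts? nestedQuads} _

outerFrameFacts : All OuterFacts outerQuints
outerFrameFacts = toWitness {a? = all? outerFacts? outerQuints} _

-- a frame (W , e , m): apex W with legs e and m
Frame : Subset 5 → Subset 5 → Subset 5 → Set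
Frame W e m = (W , e , m) ∈ map nestedFrame nestedQuads ⊎ (W , e , m) ∈ map outerFrame outerQuints

FramedAt : Subset 5 → Subset 5 → Subset 5 → Set
FramedAt W e m = Frame W e m ⊎ Frame W m e

FramedCycle : Subset 5 → Subset 5 → Subset 5 → Subset 5 → Set
FramedCycle A B C D = FramedAt A D B ⊎ FramedAt B A C ⊎ FramedAt C B D ⊎ FramedAt D C A

frame? : ∀ W e m → Dec (Frame W e m)
frame? W e m =
  ∈-dec _≟³_ (W , e , m) (map nestedFrame nestedQuads) ⊎-dec ∈-dec _≟³_ (W , e , m) (map outerFrame outerQuints)

framedAt? : ∀ W e m → Dec (FramedAt W e m)
framedAt? W e m = frame? W e m ⊎-dec frame? W m e

framedCycle? : ∀ A B C D → Dec (FramedCycle A B C D)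
framedCycle? A B C D = framedAt? A D B ⊎-dec framedAt? B A C ⊎-dec framedAt? C B D ⊎-dec framedAt? D C A

EveryFourCycleFramed : Set
EveryFourCycleFramed =
  All (λ A → All (λ B → MayAdj A B → All (λ C → MayAdj B C → C ≢ A →
    All (λ D → MayAdj C D → MayAdj D A → D ≢ B → FramedCycle A B C D)
    properIntervals) properIntervals) properIntervals) properIntervals

everyFourCycleFramed? : Dec EveryFourCycleFramed
everyFourCycleFramed? =
  all? (λ A → all? (λ B → mayAdj? A B →-dec all? (λ C → mayAdj? B C →-dec ¬? (C ≟ˢ A) →-dec
    all? (λ D → mayAdj? C D →-dec mayAdj? D A →-dec ¬? (D ≟ˢ B) →-dec framedCycle? A B C D)
    properIntervals) properIntervals) properIntervals) properIntervals

fourCycle-framed : ∀ {A B C D} →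
                   A ∈ properIntervals → B ∈ properIntervals → C ∈ properIntervals → D ∈ properIntervals →
                   MayAdj A B → MayAdj B C → MayAdj C D → MayAdj D A → C ≢ A → D ≢ B → FramedCycle A B C D
fourCycle-framed A∈ B∈ C∈ D∈ AB BC CD DA C≢A D≢B =
  All.lookup (All.lookup (All.lookup (All.lookup everyFourCycleFramed A∈) B∈ AB) C∈ BC C≢A) D∈ CD DA D≢B
  where
  everyFourCycleFramed : EveryFourCycleFramed
  everyFourCycleFramed = toWitness {a? = everyFourCycleFramed?} _

module _ (O : FlagOrdering) where
  open FlagOrdering O

  Stage : ℕ → Subset 5 → Set
  Stage = Bpre O

  ⁅⁆∈D : ∀ x → ⁅ x ⁆ ∈ descSets tree
  ⁅⁆∈D x = ⁅⁆∈descSets tree (subst (x ∈ˢ_) (sym (proj₂ treeOK)) ∈⊤)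

  Full∈D : Full ∈ descSets tree
  Full∈D = subst (_∈ descSets tree) (proj₂ treeOK) (leafSet∈descSets tree)

  stage-⁅⁆ : ∀ j x → Stage j ⁅ x ⁆
  stage-⁅⁆ j x = inj₁ (⁅⁆∈D x)

  stage-interval : ∀ {j Z} → Stage j Z → Z ∈ intervals
  stage-interval     (inj₁ Z∈D)  = BCyc5⇒∈intervals (All.lookup DinB Z∈D)
  stage-interval {j} (inj₂ Z∈bs) = BCyc5⇒∈intervals (proj₁ (Equivalence.to (bsEnum _) (∈-take⁻ j bs Z∈bs)))

  alwaysPresent⇒stage : ∀ {j Z} → Z ∈ alwaysPresent → Stage j Z
  alwaysPresent⇒stage (here refl) = inj₁ Full∈D
  alwaysPresent⇒stage {j} (there Z∈) with ∈-map⁻ ⁅_⁆ {xs = allFin 5} Z∈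
  ... | x , _ , refl = stage-⁅⁆ j x

  stage-mono : ∀ {i j Z} → i ≤ j → Stage i Z → Stage j Z
  stage-mono i≤j (inj₁ Z∈D)  = inj₁ Z∈D
  stage-mono i≤j (inj₂ Z∈bs) = inj₂ (∈-take-mono bs i≤j Z∈bs)

  stage? : ∀ j Z → Dec (Stage j Z)
  stage? j Z = ∈-dec _≟ˢ_ Z (descSets tree) ⊎-dec ∈-dec _≟ˢ_ Z (take j bs)

  stage-∪ : ∀ {j X Y} → j ≤ k O → Stage j X → Stage j Y → Nonempty (X ∩ Y) → Stage j (X ∪ Y)
  stage-∪ j≤k = proj₂ (proj₂ (proj₁ (flagSteps _ j≤k))) _ _

  stage-pairs-absent⇒absent : ∀ {j xs Ls} → j ≤ k O → PairIntervalsIn xs Ls →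
                              All (λ Z → ¬ Stage j Z) Ls → ¬ Stage j ⟦ xs ⟧
  stage-pairs-absent⇒absent {j} {xs} j≤k (distinct , 2≤ , pairs) Ls-absent =
    pairs-absent⇒absent (Stage j) (proj₂ (flagSteps _ j≤k)) (stage-⁅⁆ j) xs distinct 2≤ pair-absent
    where
    pair-absent : ∀ {x y} → x ∈ xs → y ∈ xs → x ≢ y → ¬ Stage j (⁅ x ⁆ ∪ ⁅ y ⁆)
    pair-absent x∈ y∈ x≢y with All.lookup (All.lookup pairs x∈) y∈
    ... | inj₁ x≡y                   = ⊥-elim (x≢y x≡y)
    ... | inj₂ (inj₁ pair∈Ls)        = All.lookup Ls-absent pair∈Ls
    ... | inj₂ (inj₂ pair∉intervals) = pair∉intervals ∘ stage-interval

  -- X = b_{p+1} in the paper's indexing: X enters exactly at stage B_{p+1}.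
  record AddedAt (X : Subset 5) (p : ℕ) : Set where
    field
      bounded  : p < k O
      present  : ∀ {j} → p < j → Stage j X
      later    : ∀ {j} → Stage j X → p < j
      only-new : ∀ {Z} → Stage (suc p) Z → Stage p Z ⊎ Z ≡ X

    absent : ∀ {j} → j ≤ p → ¬ Stage j X
    absent j≤p X∈ = <-irrefl refl (<-≤-trans (later X∈) j≤p)

    still-absent : ∀ {Z} → ¬ Stage p Z → Z ≢ X → ¬ Stage (suc p) Z
    still-absent Z∉ Z≢X Z∈ = [ Z∉ , Z≢X ] (only-new Z∈)

  open AddedAt

  b-enumerated : ∀ i → BCyc5 (b O i) × b O i ∉ descSets tree
  b-enumerated i = Equivalence.to (bsEnum _) (∈-lookup i)

  b-addedAt : ∀ i → AddedAt (b O i) (toℕ i)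
  b-addedAt i = record
    { bounded  = toℕ<n i
    ; present  = λ i<j → inj₂ (lookup∈take bs i i<j)
    ; later    = λ { (inj₁ bᵢ∈D) → ⊥-elim (proj₂ (b-enumerated i) bᵢ∈D)
                   ; (inj₂ bᵢ∈)  → lookup∈take⇒< bsUnique i bᵢ∈ }
    ; only-new = λ { (inj₁ Z∈D) → inj₁ (inj₁ Z∈D)
                   ; (inj₂ Z∈)  → map₁ inj₂ (∈-take-suc⁻ bs i Z∈) }
    }

  b∈properIntervals : ∀ i → b O i ∈ properIntervals
  b∈properIntervals i with b-enumerated i
  ... | bᵢ∈BCyc5 , bᵢ∉D with BCyc5-cases bᵢ∈BCyc5
  ...   | inj₁ (x , bᵢ≡⁅x⁆)   = ⊥-elim (bᵢ∉D (subst (_∈ descSets tree) (sym bᵢ≡⁅x⁆) (⁅⁆∈D x)))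
  ...   | inj₂ (inj₁ proper)  = proper
  ...   | inj₂ (inj₂ bᵢ≡Full) = ⊥-elim (bᵢ∉D (subst (_∈ descSets tree) (sym bᵢ≡Full) Full∈D))

  U-edge V-edge : ℕ → Subset 5 → Subset 5 → Set
  U-edge p X Y = ¬ (X ⊆ Y) × ¬ (Σ (Subset 5) λ c → Stage p c × (c ─ Y ≡ X ─ Y))
  V-edge p X Y = X ⊆ Y × (Σ (Subset 5) λ c → Stage p c × X ⊂ c × c ⊂ Y)

  -- ΓOAdj O i j unfolds to Adjacent (b O i) (b O j) (toℕ i) (toℕ j).
  Adjacent : Subset 5 → Subset 5 → ℕ → ℕ → Set
  Adjacent X Y p q = (p < q × (U-edge p X Y ⊎ V-edge p X Y)) ⊎ (q < p × (U-edge q Y X ⊎ V-edge q Y X))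

  U-edge⇒absent : ∀ {p X Y Z} → U-edge p X Y → Z ─ Y ≡ X ─ Y → ¬ Stage p Z
  U-edge⇒absent (_ , no-witness) Z─Y≡X─Y Z∈ = no-witness (_ , Z∈ , Z─Y≡X─Y)

  U-edge⇒MayU : ∀ {p X Y} → U-edge p X Y → MayU X Y
  U-edge⇒MayU {p} (X⊈Y , no-witness) = X⊈Y , no-witness ∘ witness ∘ find
    where
    witness : ∀ {X Y} → ∃ (λ c → c ∈ alwaysPresent × c ─ Y ≡ X ─ Y) →
              Σ (Subset 5) λ c → Stage p c × (c ─ Y ≡ X ─ Y)
    witness (c , c∈ , c─Y≡X─Y) = c , alwaysPresent⇒stage c∈ , c─Y≡X─Y

  V-edge⇒MayV : ∀ {p X Y} → V-edge p X Y → MayV X Y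
  V-edge⇒MayV (X⊆Y , c , c∈ , X⊂c , c⊂Y) =
    X⊆Y , lose (stage-interval c∈)
                (proj₁ X⊂c , proj₁ c⊂Y , (λ c≡X → ⊂-irref (sym c≡X) X⊂c) , (λ c≡Y → ⊂-irref c≡Y c⊂Y))

  edge⇒MayPrecede : ∀ {p X Y} → U-edge p X Y ⊎ V-edge p X Y → MayPrecede X Y
  edge⇒MayPrecede (inj₁ U) = inj₁ (U-edge⇒MayU U)
  edge⇒MayPrecede (inj₂ V) = inj₂ (V-edge⇒MayV V)

  adjacent⇒MayAdj : ∀ {X Y p q} → Adjacent X Y p q → MayAdj X Y
  adjacent⇒MayAdj (inj₁ (_ , edge)) = inj₁ (edge⇒MayPrecede edge)
  adjacent⇒MayAdj (inj₂ (_ , edge)) = inj₂ (edge⇒MayPrecede edge)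

  adjacent-⊃ : ∀ {X Y p q} → Adjacent X Y p q → Y ⊂ X → (p < q × U-edge p X Y) ⊎ (q < p × V-edge q Y X)
  adjacent-⊃ (inj₁ (p<q , inj₁ U))          _   = inj₁ (p<q , U)
  adjacent-⊃ (inj₁ (_ , inj₂ (X⊆Y , _)))     Y⊂X = ⊥-elim (⊂-irref refl (⊆-⊂-trans X⊆Y Y⊂X))
  adjacent-⊃ (inj₂ (_ , inj₁ (Y⊈X , _)))     Y⊂X = ⊥-elim (Y⊈X (proj₁ Y⊂X))
  adjacent-⊃ (inj₂ (q<p , inj₂ V))          _   = inj₂ (q<p , V)

  adjacent-onlyU : ∀ {X Y p q} → Adjacent X Y p q → OnlyU X Y → U-edge p X Y
  adjacent-onlyU (inj₁ (_ , inj₁ U)) _                = U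
  adjacent-onlyU (inj₁ (_ , inj₂ V)) (_ , ¬MayV , _)  = ⊥-elim (¬MayV (V-edge⇒MayV V))
  adjacent-onlyU (inj₂ (_ , inj₁ U)) (¬MayU , _)      = ⊥-elim (¬MayU (U-edge⇒MayU U))
  adjacent-onlyU (inj₂ (_ , inj₂ V)) (_ , _ , ¬MayV)  = ⊥-elim (¬MayV (V-edge⇒MayV V))

  module NestedFrameApex (x₁ x₂ x₃ x₄ : Fin 5) where
    open NestedFrame x₁ x₂ x₃ x₄

    module _
      (p12⊂p1234 : p12 ⊂ p1234) (p23⊂p1234 : p23 ⊂ p1234)
      (p34─p12 : p34 ─ p12 ≡ p1234 ─ p12) (p234─p12 : p234 ─ p12 ≡ p1234 ─ p12) (p34≢p1234 : p34 ≢ p1234)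
      (between-p12 : All (λ Z → p12 ⊂ Z → Z ⊂ p1234 → Z ≡ p123) intervals)
      (between-p23 : All (λ Z → p23 ⊂ Z → Z ⊂ p1234 → Z ≡ p123 ⊎ Z ≡ p234) intervals)
      (pairs-p1234 : PairIntervalsIn (x₁ ∷ x₂ ∷ x₃ ∷ x₄ ∷ []) (p12 ∷ p23 ∷ p34 ∷ []))
      (pairs-p123 : PairIntervalsIn (x₁ ∷ x₂ ∷ x₃ ∷ []) (p12 ∷ p23 ∷ []))
      (pairs-p234 : PairIntervalsIn (x₂ ∷ x₃ ∷ x₄ ∷ []) (p23 ∷ p34 ∷ []))
      (p123∩p34 : Nonempty (p123 ∩ p34)) (p123∪p34 : p123 ∪ p34 ≡ p1234)
      {pW pa pc : ℕ} (W-added : AddedAt p1234 pW) (a-added : AddedAt p12 pa) (c-added : AddedAt p23 pc)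
      where

      p123-absent : ∀ {j} → j ≤ pa → j ≤ pc → ¬ Stage j p123
      p123-absent j≤pa j≤pc =
        stage-pairs-absent⇒absent (≤-trans j≤pa (<⇒≤ (bounded a-added))) pairs-p123
          (absent a-added j≤pa ∷ absent c-added j≤pc ∷ [])

      p123-after-p12 : V-edge pa p12 p1234 → Stage pa p123
      p123-after-p12 (_ , Z , Z∈ , p12⊂Z , Z⊂W) with All.lookup between-p12 (stage-interval Z∈) p12⊂Z Z⊂W
      ... | refl = Z∈

      p123-or-p234-before-p23 : V-edge pc p23 p1234 → Stage pc p123 ⊎ Stage pc p234
      p123-or-p234-before-p23 (_ , Z , Z∈ , p23⊂Z , Z⊂W) with All.lookup between-p23 (stage-interval Z∈) p23⊂Z Z⊂W
      ... | inj₁ refl = inj₁ Z∈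
      ... | inj₂ refl = inj₂ Z∈

      p34-before-p234 : ∀ {j} → j ≤ pc → Stage j p234 → Stage j p34
      p34-before-p234 {j} j≤pc p234∈ with stage? j p34
      ... | yes p34∈ = p34∈
      ... | no p34∉ = ⊥-elim (stage-pairs-absent⇒absent (≤-trans j≤pc (<⇒≤ (bounded c-added))) pairs-p234
                                (absent c-added j≤pc ∷ p34∉ ∷ []) p234∈)

      apex-first : pW < pa → U-edge pW p1234 p12 → Adjacent p1234 p23 pW pc → ⊥
      apex-first pW<pa U adj with adjacent-⊃ adj p23⊂p1234
      ... | inj₁ (pW<pc , _) =
        stage-pairs-absent⇒absent (bounded W-added) pairs-p1234
          (absent a-added pW<pa ∷ absent c-added pW<pc
            ∷ still-absent W-added (U-edge⇒absent U p34─p12) p34≢p1234 ∷ [])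
          (present W-added (n<1+n pW))
      ... | inj₂ (pc<pW , V) with p123-or-p234-before-p23 V
      ...   | inj₁ p123∈ = p123-absent (<⇒≤ (<-trans pc<pW pW<pa)) ≤-refl p123∈
      ...   | inj₂ p234∈ = U-edge⇒absent U p234─p12 (stage-mono (<⇒≤ pc<pW) p234∈)

      leg-first : pa < pW → Stage pa p123 → Adjacent p1234 p23 pW pc → ⊥
      leg-first pa<pW p123∈ adj with pa ≤? pc
      ... | yes pa≤pc = p123-absent ≤-refl pa≤pc p123∈
      ... | no pa≰pc with adjacent-⊃ adj p23⊂p1234
      ...   | inj₁ (pW<pc , _) = <-irrefl refl (<-trans pW<pc (<-trans (≰⇒> pa≰pc) pa<pW))
      ...   | inj₂ (_ , V) with p123-or-p234-before-p23 V
      ...     | inj₁ p123∈pc = p123-absent (<⇒≤ (≰⇒> pa≰pc)) ≤-refl p123∈pc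
      ...     | inj₂ p234∈pc = <-irrefl refl (<-trans pa<pW (later W-added p1234∈pa))
        where
        pa≤k : pa ≤ k O
        pa≤k = <⇒≤ (bounded a-added)
        p34∈pa : Stage pa p34
        p34∈pa = stage-mono (<⇒≤ (≰⇒> pa≰pc)) (p34-before-p234 ≤-refl p234∈pc)
        p1234∈pa : Stage pa p1234
        p1234∈pa = subst (Stage pa) p123∪p34 (stage-∪ pa≤k p123∈ p34∈pa p123∩p34)

      legs-not-both-adjacent : Adjacent p1234 p12 pW pa → Adjacent p1234 p23 pW pc → ⊥
      legs-not-both-adjacent adj-a adj-c with adjacent-⊃ adj-a p12⊂p1234
      ... | inj₁ (pW<pa , U) = apex-first pW<pa U adj-c
      ... | inj₂ (pa<pW , V) = leg-first pa<pW (p123-after-p12 V) adj-c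

    apex-misses-a-leg : Facts → ∀ {pW pa pc} → AddedAt p1234 pW → AddedAt p12 pa → AddedAt p23 pc →
                        Adjacent p1234 p12 pW pa → Adjacent p1234 p23 pW pc → ⊥
    apex-misses-a-leg (f₁ , f₂ , f₃ , f₄ , f₅ , f₆ , f₇ , f₈ , f₉ , f₁₀ , f₁₁ , f₁₂) =
      legs-not-both-adjacent f₁ f₂ f₃ f₄ f₅ f₆ f₇ f₈ f₉ f₁₀ f₁₁ f₁₂

  module OuterFrameApex (x₀ x₁ x₂ x₃ x₄ : Fin 5) where
    open OuterFrame x₀ x₁ x₂ x₃ x₄

    module _
      (onlyU-p01 : OnlyU p123 p01) (p23─p01 : p23 ─ p01 ≡ p123 ─ p01)
      (onlyU-p34 : OnlyU p123 p34) (p12─p34 : p12 ─ p34 ≡ p123 ─ p34)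
      (pairs-p123 : PairIntervalsIn (x₁ ∷ x₂ ∷ x₃ ∷ []) (p12 ∷ p23 ∷ []))
      (p12≢p123 : p12 ≢ p123) (p23≢p123 : p23 ≢ p123)
      {pT pe pf : ℕ} (T-added : AddedAt p123 pT)
      where

      legs-not-both-adjacent : Adjacent p123 p01 pT pe → Adjacent p123 p34 pT pf → ⊥
      legs-not-both-adjacent adj-e adj-f =
        stage-pairs-absent⇒absent (bounded T-added) pairs-p123
          (still-absent T-added p12-absent p12≢p123 ∷ still-absent T-added p23-absent p23≢p123 ∷ [])
          (present T-added (n<1+n pT))
        where
        p12-absent : ¬ Stage pT p12
        p12-absent = U-edge⇒absent (adjacent-onlyU adj-f onlyU-p34) p12─p34
        p23-absent : ¬ Stage pT p23
        p23-absent = U-edge⇒absent (adjacent-onlyU adj-e onlyU-p01) p23─p01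

    apex-misses-a-leg : Facts → ∀ {pT pe pf} → AddedAt p123 pT →
                        Adjacent p123 p01 pT pe → Adjacent p123 p34 pT pf → ⊥
    apex-misses-a-leg (f₁ , f₂ , f₃ , f₄ , f₅ , f₆ , f₇) = legs-not-both-adjacent f₁ f₂ f₃ f₄ f₅ f₆ f₇

  frame-apex : ∀ {W e m pW pe pm} → Frame W e m → AddedAt W pW → AddedAt e pe → AddedAt m pm →
               Adjacent W e pW pe → Adjacent W m pW pm → ⊥
  frame-apex (inj₁ nested) W-added e-added m-added with ∈-map⁻ nestedFrame nested
  ... | (x₁ , x₂ , x₃ , x₄) , q∈ , refl =
    NestedFrameApex.apex-misses-a-leg x₁ x₂ x₃ x₄ (All.lookup nestedFrameFacts q∈) W-added e-added m-added
  frame-apex (inj₂ outer) W-added _ _ with ∈-map⁻ outerFrame outer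
  ... | (x₀ , x₁ , x₂ , x₃ , x₄) , q∈ , refl =
    OuterFrameApex.apex-misses-a-leg x₀ x₁ x₂ x₃ x₄ (All.lookup outerFrameFacts q∈) W-added

  framedAt-apex : ∀ {W e m pW pe pm} → FramedAt W e m → AddedAt W pW → AddedAt e pe → AddedAt m pm →
                  Adjacent W e pW pe → Adjacent W m pW pm → ⊥
  framedAt-apex (inj₁ frame) W-added e-added m-added adj-e adj-m =
    frame-apex frame W-added e-added m-added adj-e adj-m
  framedAt-apex (inj₂ frame) W-added e-added m-added adj-e adj-m =
    frame-apex frame W-added m-added e-added adj-m adj-e

  b-distinct : ∀ {i j} → i ≢ j → b O i ≢ b O j
  b-distinct i≢j = i≢j ∘ lookup-injective bsUnique _ _

  ΓO-noFourCycle : ¬ FourCycle (ΓOAdj O)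
  ΓO-noFourCycle cycle =
    framed-vertex (fourCycle-framed (b∈properIntervals v₀) (b∈properIntervals v₁)
                                    (b∈properIntervals v₂) (b∈properIntervals v₃)
                                    (adjacent⇒MayAdj e₀₁) (adjacent⇒MayAdj e₁₂)
                                    (adjacent⇒MayAdj e₂₃) (adjacent⇒MayAdj e₃₀)
                                    (b-distinct (v₀≢v₂ ∘ sym)) (b-distinct (v₁≢v₃ ∘ sym)))
    where
    open FourCycle cycle
    framed-vertex : FramedCycle (b O v₀) (b O v₁) (b O v₂) (b O v₃) → ⊥
    framed-vertex (inj₁ framed) =
      framedAt-apex framed (b-addedAt v₀) (b-addedAt v₃) (b-addedAt v₁) (swap e₃₀) e₀₁
    framed-vertex (inj₂ (inj₁ framed)) =
      framedAt-apex framed (b-addedAt v₁) (b-addedAt v₀) (b-addedAt v₂) (swap e₀₁) e₁₂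
    framed-vertex (inj₂ (inj₂ (inj₁ framed))) =
      framedAt-apex framed (b-addedAt v₂) (b-addedAt v₁) (b-addedAt v₃) (swap e₁₂) e₂₃
    framed-vertex (inj₂ (inj₂ (inj₂ framed))) =
      framedAt-apex framed (b-addedAt v₃) (b-addedAt v₂) (b-addedAt v₀) (swap e₂₃) e₃₀

P5Adj-sym : ∀ u v → P5Adj u v → P5Adj v u
P5Adj-sym ⟨ _ , _ , _ ⟩ ⟨ _ , _ , _ ⟩ ((l≢l' , l≢r' , r≢l' , r≢r') , order) =
  (l≢l' ∘ sym , r≢l' ∘ sym , l≢r' ∘ sym , r≢r' ∘ sym) , swap order

P5Adj-irrefl : ∀ u → ¬ P5Adj u u
P5Adj-irrefl ⟨ _ , _ , _ ⟩ ((l≢l , _) , _) = l≢l refl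

P5-fourCycle : FourCycle P5Adj
P5-fourCycle = record
  { v₀ = ⟨ # 0 , # 1 , (λ ()) ⟩
  ; v₁ = ⟨ # 2 , # 3 , (λ ()) ⟩
  ; v₂ = ⟨ # 1 , # 0 , (λ ()) ⟩
  ; v₃ = ⟨ # 3 , # 2 , (λ ()) ⟩
  ; e₀₁ = ((λ ()) , (λ ()) , (λ ()) , (λ ())) , inj₁ (z<s , s<s z<s)
  ; e₁₂ = ((λ ()) , (λ ()) , (λ ()) , (λ ())) , inj₂ (s<s z<s , z<s)
  ; e₂₃ = ((λ ()) , (λ ()) , (λ ()) , (λ ())) , inj₁ (s<s z<s , z<s)
  ; e₃₀ = ((λ ()) , (λ ()) , (λ ()) , (λ ())) , inj₂ (z<s , s<s z<s)
  ; v₀≢v₂ = λ ()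
  ; v₁≢v₃ = λ ()
  }

proposition4p6 : (O : FlagOrdering) → ¬ CliqueComplexIso (ΓOAdj O) P5Adj
proposition4p6 O iso = ΓO-noFourCycle O (fourCycle-reflected iso P5Adj-sym P5Adj-irrefl P5-fourCycle)
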